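{- Let $m\ge2$ and let $\mathcal{B}_U(m)$ be the homogeneous tree of degree $m+1$ with basin a single vertex $\mathcal{O}_0$. Let $\mathcal{O}_0,\mathcal{O}_1,\mathcal{O}_2,\dots$ be the consecutive vertices of a geodesic ray starting at $\mathcal{O}_0$ (so $h(\mathcal{O}_n)=n$). Then for every $n\ge1$, $$\zeta_{\mathcal{O}_n}(X)=\frac{1+(m-1)X^2+m(m-1)X^4+\cdots+m^{n-2}(m-1)X^{2(n-1)}+m^nX^{2n}}{1-X^2}$$ and $$\zeta^{\mathcal{P}}_{\mathcal{O}_n}(X)=\frac{1+X+m(X^2+X^3)+\cdots+m^{n-1}(X^{2n-2}+X^{2n-1})+m^nX^{2n}}{1-X^2}.$$
   Context: For a tree with basin $\mathcal{P}$: $\mathcal{P}_0=\mathcal{P}$, $\mathcal{P}_n=\{x: d(x,\mathcal{P}_{n-1})\le1\}$, $\mathcal{R}_0=\mathcal{P}$, $\mathcal{R}_n=\mathcal{P}_n\setminus\mathcal{P}_{n-1}$, $h(v)$ the unique $n$ with $v\in\mathcal{R}_n$. $\zeta_v(X)=\sum_{d\ge0}\#\{x\in\mathcal{R}_{h(v)}: x \text{ reachable from } v \text{ by a path of length } d\}X^d$ and $\zeta^{\mathcal{P}}_v(X)$ is the same with $\mathcal{P}_{h(v)}$ in place of $\mathcal{R}_{h(v)}$; paths are walks, possibly backtracking. -}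

module Defs where

open import Data.Nat using (ℕ; zero; suc; _+_; _*_; _∸_; _^_; _≤_; _≡ᵇ_; _<ᵇ_; _/_; _%_)
open import Data.Bool using (if_then_else_; _∧_)
open import Data.Fin using (Fin)
open import Data.List using (List; []; _∷_; length)
open import Data.List.Membership.Propositional using (_∈_)
open import Data.List.Relation.Unary.Unique.Propositional using (Unique)
open import Data.Maybe using (Maybe; nothing; just)
open import Data.Product using (Σ; _×_; _,_)
open import Data.Sum using (_⊎_)
open import Function using (_⇔_)
open import Relation.Nullary using (¬_)
open import Relation.Binary.PropositionalEquality using (_≡_)

-- A vertex is either the root (nothing) or a path from the root:
-- the first step chooses one of the m+1 neighbours of the root
-- (Fin (suc m)), each further step chooses one of the m children of
-- a non-root vertex (Fin m).  The list of later choices is stored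
-- newest-first.

V : ℕ → Set
V m = Maybe (Fin (suc m) × List (Fin m))

root : ∀ {m} → V m
root = nothing

data ChildOf {m : ℕ} : V m → V m → Set where
  fromRoot : (a : Fin (suc m)) → ChildOf nothing (just (a , []))
  deeper   : (a : Fin (suc m)) (c : Fin m) (cs : List (Fin m)) →
             ChildOf (just (a , cs)) (just (a , c ∷ cs))

Adj : ∀ {m} → V m → V m → Set
Adj u v = ChildOf u v ⊎ ChildOf v u

data Walk {m : ℕ} : V m → V m → ℕ → Set where
  here : ∀ {x} → Walk x x 0
  step : ∀ {x y z d} → Adj x y → Walk y z d → Walk x z (suc d)

IsDist : ∀ {m} → V m → V m → ℕ → Set
IsDist x y d = Walk x y d × (∀ e → Walk x y e → d ≤ e)

Pset : ∀ {m} → ℕ → V m → Set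
Pset zero    x = x ≡ root
Pset (suc n) x = Σ _ λ y → Pset n y × (x ≡ y ⊎ Adj x y)

Rset : ∀ {m} → ℕ → V m → Set
Rset zero    x = Pset zero x
Rset (suc n) x = Pset (suc n) x × ¬ Pset n x

HasCount : ∀ {m} → (V m → Set) → ℕ → Set
HasCount {m} P c =
  Σ (List (V m)) λ xs → Unique xs × (∀ x → (x ∈ xs) ⇔ P x) × length xs ≡ c

-- The coefficient of X^d in ζ_v(X) is c  (n plays the role of h(v),
-- the unique n with v ∈ R_n).
ZetaCoeff : ∀ {m} → V m → ℕ → ℕ → Set
ZetaCoeff v d c = Σ ℕ λ n → Rset n v × HasCount (λ x → Rset n x × Walk v x d) c

ZetaPCoeff : ∀ {m} → V m → ℕ → ℕ → Set
ZetaPCoeff v d c = Σ ℕ λ n → Rset n v × HasCount (λ x → Pset n x × Walk v x d) c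

IsGeodesicRay : ∀ {m} → (ℕ → V m) → Set
IsGeodesicRay O = O 0 ≡ root × (∀ i j → IsDist (O i) (O j) (Data.Nat.∣ i - j ∣))

-- Formal power series with ℕ coefficients, given as coefficient
-- functions.  divOneMinusX² N is the series N(X) / (1 - X²).

divOneMinusX² : (ℕ → ℕ) → ℕ → ℕ
divOneMinusX² N zero          = N zero
divOneMinusX² N (suc zero)    = N (suc zero)
divOneMinusX² N (suc (suc d)) = N (suc (suc d)) + divOneMinusX² N d

-- Coefficient of X^j in
--   1 + (m-1)X² + m(m-1)X⁴ + … + m^{n-2}(m-1)X^{2(n-1)} + m^n X^{2n}
num₁ : ℕ → ℕ → ℕ → ℕ
num₁ m n j =
  if j % 2 ≡ᵇ 0
  then (if k ≡ᵇ 0 then 1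
        else if k <ᵇ n then m ^ (k ∸ 1) * (m ∸ 1)
        else if k ≡ᵇ n then m ^ n
        else 0)
  else 0
  where k = j / 2

-- Coefficient of X^j in
--   1 + X + m(X² + X³) + … + m^{n-1}(X^{2n-2} + X^{2n-1}) + m^n X^{2n}
num₂ : ℕ → ℕ → ℕ → ℕ
num₂ m n j =
  if k <ᵇ n then m ^ k
  else if (k ≡ᵇ n) ∧ (j % 2 ≡ᵇ 0) then m ^ n
  else 0
  where k = j / 2

-- Every walk in a tree has a normal form: climb a steps, make t out-and-back excursions,
-- descend b steps, with a + b + 2t its length.  Between two vertices of the same depth the
-- climb and the descent agree, so such walks have even length 2k and exist exactly when
-- the two vertices share their k-th ancestor.  Counting these vertices gives m^k while k is
-- below the depth n and the whole level (m+1)m^(n-1) from then on: these are the partial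
-- sums of the first numerator, i.e. the coefficients of ζ.  For ζᴾ, a walk of length d+1
-- from a vertex of depth n into P_(n-1) may as well start with the step to the parent,
-- whence ζᴾₙ = ζₙ + X ζᴾₙ₋₁, which is the recursion satisfied by the second numerator.

module Submission where

open import Defs
open import Algebra.Properties.CommutativeSemigroup using (interchange; xy∙z≈xz∙y)
open import Data.Bool.Properties using (∧-zeroʳ)
open import Data.Empty using (⊥-elim)
open import Data.Fin using (Fin) renaming (zero to fzero)
open import Data.List using (List; []; _∷_; length; map; _++_; cartesianProduct; allFin)
open import Data.List.Membership.Propositional using (_∈_)
open import Data.List.Membership.Propositional.Properties
  using (∈-map⁺; ∈-map⁻; ∈-++⁺ˡ; ∈-++⁺ʳ; ∈-++⁻; ∈-cartesianProduct⁺; ∈-cartesianProduct⁻; ∈-allFin)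
open import Data.List.Properties using (length-map; length-++; length-tabulate; ++-cancelʳ)
open import Data.List.Relation.Unary.Any using (here)
open import Data.List.Relation.Unary.All using ([])
open import Data.List.Relation.Unary.AllPairs using ([]; _∷_)
open import Data.List.Relation.Unary.Unique.Propositional using (Unique)
open import Data.List.Relation.Unary.Unique.Propositional.Properties
  using (map⁺; ++⁺; cartesianProduct⁺; allFin⁺)
open import Data.Maybe using (nothing; just)
open import Data.Maybe.Properties using (just-injective)
open import Data.Nat hiding (parity)
open import Data.Nat.DivMod using (m/n≡1+[m∸n]/n)
open import Data.Nat.Properties
open import Data.Product using (Σ; ∃; _×_; _,_; proj₁; proj₂)
open import Data.Product.Function.NonDependent.Propositional using (_×-⇔_)
open import Data.Sum using (_⊎_; inj₁; inj₂; swap)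
open import Data.Unit using (⊤; tt)
open import Function using (_⇔_; mk⇔; Equivalence; _∘_; _∘′_; case_of_)
open import Function.Definitions using (Injective)
open import Function.Properties.Equivalence using () renaming (trans to ⇔-trans; sym to ⇔-sym; refl to ⇔-refl)
open import Relation.Binary.Definitions using (tri<; tri≈; tri>)
open import Relation.Binary.PropositionalEquality
open import Relation.Nullary using (¬_; yes; no)
open import Relation.Nullary.Decidable using (dec-true; dec-false)

open Equivalence

HasSize : {A : Set} → (A → Set) → ℕ → Set
HasSize {A} P c = Σ (List A) λ xs → Unique xs × (∀ x → (x ∈ xs) ⇔ P x) × length xs ≡ c

module _ {A : Set} {P Q : A → Set} where

  hasSize-resp : ∀ {c} → (∀ x → P x ⇔ Q x) → HasSize P c → HasSize Q c
  hasSize-resp P⇔Q (xs , u , mem , l) = xs , u , (λ x → ⇔-trans (mem x) (P⇔Q x)) , l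

  hasSize-⊎ : ∀ {a b} → (∀ x → P x → ¬ Q x) → HasSize P a → HasSize Q b →
              HasSize (λ x → P x ⊎ Q x) (a + b)
  hasSize-⊎ disjoint (xs , u , mem , refl) (ys , v , mem′ , refl) =
    xs ++ ys ,
    ++⁺ u v (λ (x∈xs , x∈ys) → disjoint _ (to (mem _) x∈xs) (to (mem′ _) x∈ys)) ,
    (λ x → mk⇔ (into x ∘ ∈-++⁻ xs)
               λ { (inj₁ p) → ∈-++⁺ˡ (from (mem x) p) ; (inj₂ q) → ∈-++⁺ʳ xs (from (mem′ x) q) }) ,
    length-++ xs
    where
    into : ∀ x → x ∈ xs ⊎ x ∈ ys → P x ⊎ Q x
    into x (inj₁ x∈xs) = inj₁ (to (mem x) x∈xs)
    into x (inj₂ x∈ys) = inj₂ (to (mem′ x) x∈ys)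

module _ {A : Set} where

  hasSize-∅ : {P : A → Set} → (∀ x → ¬ P x) → HasSize P 0
  hasSize-∅ ¬P = [] , [] , (λ x → mk⇔ (λ ()) (⊥-elim ∘′ ¬P x)) , refl

  hasSize-singleton : (a : A) → HasSize (_≡ a) 1
  hasSize-singleton a = a ∷ [] , [] ∷ [] , (λ x → mk⇔ (λ { (here x≡a) → x≡a }) here) , refl

module _ {A B : Set} where

  hasSize-image : ∀ {P : A → Set} {c} (f : A → B) → Injective _≡_ _≡_ f → HasSize P c →
                  HasSize (λ y → ∃ λ x → P x × y ≡ f x) c
  hasSize-image f f-inj (xs , u , mem , l) =
    map f xs , map⁺ f-inj u ,
    (λ y → mk⇔ (λ y∈ → let (x , x∈xs , y≡fx) = ∈-map⁻ f y∈ in x , to (mem x) x∈xs , y≡fx)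
               λ { (x , p , refl) → ∈-map⁺ f (from (mem x) p) }) ,
    trans (length-map f xs) l

  length-cartesianProduct : (xs : List A) (ys : List B) →
                            length (cartesianProduct xs ys) ≡ length xs * length ys
  length-cartesianProduct []       ys = refl
  length-cartesianProduct (x ∷ xs) ys = begin
    length (map (x ,_) ys ++ cartesianProduct xs ys)        ≡⟨ length-++ (map (x ,_) ys) ⟩
    length (map (x ,_) ys) + length (cartesianProduct xs ys) ≡⟨ cong₂ _+_ (length-map (x ,_) ys) (length-cartesianProduct xs ys) ⟩
    length ys + length xs * length ys                       ∎
    where open ≡-Reasoning

  hasSize-× : ∀ {P : A → Set} {Q : B → Set} {a b} → HasSize P a → HasSize Q b →
              HasSize (λ (x , y) → P x × Q y) (a * b)
  hasSize-× (xs , u , mem , refl) (ys , v , mem′ , refl) =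
    cartesianProduct xs ys , cartesianProduct⁺ u v ,
    (λ (x , y) → mk⇔ (λ xy∈ → let (x∈ , y∈) = ∈-cartesianProduct⁻ xs ys xy∈ in to (mem x) x∈ , to (mem′ y) y∈)
                     λ (p , q) → ∈-cartesianProduct⁺ (from (mem x) p) (from (mem′ y) q)) ,
    length-cartesianProduct xs ys

hasSize-Fin : ∀ n → HasSize {Fin n} (λ _ → ⊤) n
hasSize-Fin n = allFin n , allFin⁺ n , (λ i → mk⇔ (λ _ → tt) (λ _ → ∈-allFin i)) , length-tabulate _

hasSize-lists : ∀ {A : Set} {c} → HasSize {A} (λ _ → ⊤) c → ∀ r → HasSize (λ (xs : List A) → length xs ≡ r) (c ^ r)
hasSize-lists enum zero    = hasSize-resp (λ xs → mk⇔ (λ { refl → refl }) (length≡0 xs)) (hasSize-singleton [])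
  where
  length≡0 : ∀ xs → length xs ≡ 0 → xs ≡ []
  length≡0 [] _ = refl
hasSize-lists enum (suc r) =
  hasSize-resp (λ xs → mk⇔ (λ { ((_ , _) , (_ , ℓ≡r) , refl) → cong suc ℓ≡r }) (uncons xs))
    (hasSize-image (λ (x , xs) → x ∷ xs) ∷-injective (hasSize-× enum (hasSize-lists enum r)))
  where
  ∷-injective : Injective _≡_ _≡_ (λ (x , xs) → x ∷ xs)
  ∷-injective refl = refl
  uncons : ∀ xs → length xs ≡ suc r → ∃ λ (x , ys) → (⊤ × length ys ≡ r) × xs ≡ x ∷ ys
  uncons (x ∷ xs) ℓ≡ = (x , xs) , (tt , suc-injective ℓ≡) , refl

double : ℕ → ℕ
double zero    = zero
double (suc k) = suc (suc (double k))

data Parity : ℕ → Set where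
  even : ∀ k → Parity (double k)
  odd  : ∀ k → Parity (suc (double k))

parity : ∀ j → Parity j
parity zero          = even 0
parity (suc zero)    = odd 0
parity (suc (suc j)) with parity j
... | even k = even (suc k)
... | odd k  = odd (suc k)

double≡+ : ∀ k → double k ≡ k + k
double≡+ zero    = refl
double≡+ (suc k) = cong suc (trans (cong suc (double≡+ k)) (sym (+-suc k k)))

double-distrib-+ : ∀ a b → double (a + b) ≡ double a + double b
double-distrib-+ zero    b = refl
double-distrib-+ (suc a) b = cong (suc ∘′ suc) (double-distrib-+ a b)

double-injective : ∀ {a b} → double a ≡ double b → a ≡ b
double-injective {zero}  {zero}  _  = refl
double-injective {suc a} {suc b} eq = cong suc (double-injective (suc-injective (suc-injective eq)))

double≢suc-double : ∀ a b → double a ≢ suc (double b)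
double≢suc-double (suc (suc a)) (suc b) eq = double≢suc-double (suc a) b (suc-injective (suc-injective eq))
double≢suc-double (suc zero)    (suc b) eq = double≢suc-double 0 b (suc-injective (suc-injective eq))

double-%2 : ∀ k → double k % 2 ≡ 0
double-%2 zero    = refl
double-%2 (suc k) = double-%2 k

suc-double-%2 : ∀ k → suc (double k) % 2 ≡ 1
suc-double-%2 zero    = refl
suc-double-%2 (suc k) = suc-double-%2 k

suc-suc-/2 : ∀ j → suc (suc j) / 2 ≡ suc (j / 2)
suc-suc-/2 j = m/n≡1+[m∸n]/n {suc (suc j)} {2} (s≤s (s≤s z≤n))

double-/2 : ∀ k → double k / 2 ≡ k
double-/2 zero    = refl
double-/2 (suc k) = trans (suc-suc-/2 (double k)) (cong suc (double-/2 k))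

suc-double-/2 : ∀ k → suc (double k) / 2 ≡ k
suc-double-/2 zero    = refl
suc-double-/2 (suc k) = trans (suc-suc-/2 (suc (double k))) (cong suc (suc-double-/2 k))

module _ (m : ℕ) where

  num₁-odd : ∀ n k → num₁ m n (suc (double k)) ≡ 0
  num₁-odd n k rewrite suc-double-%2 k = refl

  num₁-even-< : ∀ n k → suc k < n → num₁ m n (double (suc k)) ≡ m ^ k * (m ∸ 1)
  num₁-even-< n k lt rewrite double-%2 (suc k) | double-/2 (suc k) | dec-true (suc k <? n) lt = refl

  num₁-even-≡ : ∀ n → num₁ m n (double n) ≡ m ^ n
  num₁-even-≡ zero = refl
  num₁-even-≡ (suc n) rewrite double-%2 (suc n) | double-/2 (suc n)
                            | dec-false (suc n <? suc n) (<-irrefl refl) | dec-true (suc n ≟ suc n) refl = refl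

  num₁-even-> : ∀ n k → n < k → num₁ m n (double k) ≡ 0
  num₁-even-> n (suc k) lt rewrite double-%2 (suc k) | double-/2 (suc k)
                                 | dec-false (suc k <? n) (<⇒≯ lt) | dec-false (suc k ≟ n) (≢-sym (<⇒≢ lt)) = refl

  num₂-even-< : ∀ n k → k < n → num₂ m n (double k) ≡ m ^ k
  num₂-even-< n k lt rewrite double-/2 k | dec-true (k <? n) lt = refl

  num₂-even-≡ : ∀ n → num₂ m n (double n) ≡ m ^ n
  num₂-even-≡ n rewrite double-/2 n | double-%2 n | dec-false (n <? n) (<-irrefl refl) | dec-true (n ≟ n) refl = refl

  num₂-even-> : ∀ n k → n < k → num₂ m n (double k) ≡ 0
  num₂-even-> n k lt rewrite double-/2 k | dec-false (k <? n) (<⇒≯ lt) | dec-false (k ≟ n) (≢-sym (<⇒≢ lt)) = refl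

  num₂-odd-< : ∀ n k → k < n → num₂ m n (suc (double k)) ≡ m ^ k
  num₂-odd-< n k lt rewrite suc-double-/2 k | dec-true (k <? n) lt = refl

  num₂-odd-≥ : ∀ n k → n ≤ k → num₂ m n (suc (double k)) ≡ 0
  num₂-odd-≥ n k le rewrite suc-double-/2 k | suc-double-%2 k | dec-false (k <? n) (≤⇒≯ le) | ∧-zeroʳ (k ≡ᵇ n) = refl

divOneMinusX²-cong : ∀ {N N′} → (∀ j → N j ≡ N′ j) → ∀ d → divOneMinusX² N d ≡ divOneMinusX² N′ d
divOneMinusX²-cong N≗N′ zero          = N≗N′ 0
divOneMinusX²-cong N≗N′ (suc zero)    = N≗N′ 1
divOneMinusX²-cong N≗N′ (suc (suc d)) = cong₂ _+_ (N≗N′ (suc (suc d))) (divOneMinusX²-cong N≗N′ d)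

-- The numerator identity N = M + X·L passes to the quotients by 1 − X².
divOneMinusX²-+X* : ∀ {N M L} → N 0 ≡ M 0 → (∀ j → N (suc j) ≡ M (suc j) + L j) →
                    ∀ d → divOneMinusX² N (suc d) ≡ divOneMinusX² M (suc d) + divOneMinusX² L d
divOneMinusX²-+X* N₀ Nₛ zero = Nₛ 0
divOneMinusX²-+X* {M = M} {L} N₀ Nₛ (suc zero) =
  trans (cong₂ _+_ (Nₛ 1) N₀) (xy∙z≈xz∙y +-commutativeSemigroup (M 2) (L 1) (M 0))
divOneMinusX²-+X* {M = M} {L} N₀ Nₛ (suc (suc d)) =
  trans (cong₂ _+_ (Nₛ (2 + d)) (divOneMinusX²-+X* N₀ Nₛ d))
        (interchange +-commutativeSemigroup (M (3 + d)) (L (2 + d)) _ _)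

ζ ζᴾ : ℕ → ℕ → ℕ → ℕ
ζ  m n = divOneMinusX² (num₁ m n)
ζᴾ m n = divOneMinusX² (num₂ m n)

levelSize : ℕ → ℕ → ℕ
levelSize m zero    = 1
levelSize m (suc r) = suc m * m ^ r

geometric-step : ∀ m .{{_ : NonZero m}} k → m ^ k * (m ∸ 1) + m ^ k ≡ m ^ suc k
geometric-step (suc m′) k = trans (+-comm (suc m′ ^ k * m′) _) (cong (suc m′ ^ k +_) (*-comm (suc m′ ^ k) m′))

ζ-odd : ∀ m n k → ζ m n (suc (double k)) ≡ 0
ζ-odd m n zero    = num₁-odd m n 0
ζ-odd m n (suc k) = cong₂ _+_ (num₁-odd m n (suc k)) (ζ-odd m n k)

module _ (m : ℕ) .{{_ : NonZero m}} where

  ζ-double-< : ∀ n k → k < n → ζ m n (double k) ≡ m ^ k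
  ζ-double-< n zero    _  = refl
  ζ-double-< n (suc k) lt = begin
    num₁ m n (double (suc k)) + ζ m n (double k) ≡⟨ cong₂ _+_ (num₁-even-< m n k lt) (ζ-double-< n k (<-trans (n<1+n k) lt)) ⟩
    m ^ k * (m ∸ 1) + m ^ k                     ≡⟨ geometric-step m k ⟩
    m ^ suc k                                   ∎
    where open ≡-Reasoning

  ζ-double-≡ : ∀ n → ζ m n (double n) ≡ levelSize m n
  ζ-double-≡ zero    = refl
  ζ-double-≡ (suc n) = begin
    num₁ m (suc n) (double (suc n)) + ζ m (suc n) (double n) ≡⟨ cong₂ _+_ (num₁-even-≡ m (suc n)) (ζ-double-< (suc n) n (n<1+n n)) ⟩
    m ^ suc n + m ^ n                                       ≡⟨ +-comm (m ^ suc n) (m ^ n) ⟩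
    suc m * m ^ n                                           ∎
    where open ≡-Reasoning

  ζ-double-≥ : ∀ n k → n ≤ k → ζ m n (double k) ≡ levelSize m n
  ζ-double-≥ n zero    z≤n = refl
  ζ-double-≥ n (suc k) n≤1+k with m≤n⇒m<n∨m≡n n≤1+k
  ... | inj₁ (s≤s n≤k) = cong₂ _+_ (num₁-even-> m n (suc k) (s≤s n≤k)) (ζ-double-≥ n k n≤k)
  ... | inj₂ refl      = ζ-double-≡ (suc k)

  num₂-suc-even : ∀ n k → num₂ m (suc n) (suc (double k)) ≡ num₁ m (suc n) (suc (double k)) + num₂ m n (double k)
  num₂-suc-even n k with <-cmp k n
  ... | tri< k<n _ _ =
    trans (num₂-odd-< m (suc n) k (m<n⇒m<1+n k<n))
          (sym (cong₂ _+_ (num₁-odd m (suc n) k) (num₂-even-< m n k k<n)))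
  ... | tri≈ _ refl _ =
    trans (num₂-odd-< m (suc k) k (n<1+n k))
          (sym (cong₂ _+_ (num₁-odd m (suc k) k) (num₂-even-≡ m k)))
  ... | tri> _ _ n<k =
    trans (num₂-odd-≥ m (suc n) k n<k)
          (sym (cong₂ _+_ (num₁-odd m (suc n) k) (num₂-even-> m n k n<k)))

  num₂-suc-odd : ∀ n k → num₂ m (suc n) (double (suc k)) ≡ num₁ m (suc n) (double (suc k)) + num₂ m n (suc (double k))
  num₂-suc-odd n k with <-cmp k n
  ... | tri< k<n _ _ =
    trans (num₂-even-< m (suc n) (suc k) (s≤s k<n))
          (sym (trans (cong₂ _+_ (num₁-even-< m (suc n) k (s≤s k<n)) (num₂-odd-< m n k k<n)) (geometric-step m k)))
  ... | tri≈ _ refl _ =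
    trans (num₂-even-≡ m (suc k))
          (sym (trans (cong₂ _+_ (num₁-even-≡ m (suc k)) (num₂-odd-≥ m k k ≤-refl)) (+-identityʳ _)))
  ... | tri> _ _ n<k =
    trans (num₂-even-> m (suc n) (suc k) (s≤s n<k))
          (sym (cong₂ _+_ (num₁-even-> m (suc n) (suc k) (s≤s n<k)) (num₂-odd-≥ m n k (<⇒≤ n<k))))

  num₂-suc : ∀ n j → num₂ m (suc n) (suc j) ≡ num₁ m (suc n) (suc j) + num₂ m n j
  num₂-suc n j with parity j
  ... | even k = num₂-suc-even n k
  ... | odd k  = num₂-suc-odd n k

  ζᴾ-suc : ∀ n d → ζᴾ m (suc n) (suc d) ≡ ζ m (suc n) (suc d) + ζᴾ m n d
  ζᴾ-suc n = divOneMinusX²-+X* refl (num₂-suc n)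

num₂-zero : ∀ m j → num₂ m 0 j ≡ num₁ m 0 j
num₂-zero m j with parity j
... | even zero    = refl
... | even (suc k) = trans (num₂-even-> m 0 (suc k) z<s) (sym (num₁-even-> m 0 (suc k) z<s))
... | odd k        = trans (num₂-odd-≥ m 0 k z≤n) (sym (num₁-odd m 0 k))

ζᴾ-zero : ∀ m d → ζᴾ m 0 d ≡ ζ m 0 d
ζᴾ-zero m = divOneMinusX²-cong (num₂-zero m)

module _ {m : ℕ} where

  depth : V m → ℕ
  depth nothing         = 0
  depth (just (_ , cs)) = suc (length cs)

  parent : V m → V m
  parent nothing             = nothing
  parent (just (_ , []))     = nothing
  parent (just (a , _ ∷ cs)) = just (a , cs)

  -- Climbing past the root stays at the root.
  ancestor : ℕ → V m → V m
  ancestor zero    x = x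
  ancestor (suc k) x = ancestor k (parent x)

  child-parent : ∀ {u v : V m} → ChildOf u v → parent v ≡ u
  child-parent (fromRoot _)   = refl
  child-parent (deeper _ _ _) = refl

  child-depth : ∀ {u v : V m} → ChildOf u v → depth v ≡ suc (depth u)
  child-depth (fromRoot _)   = refl
  child-depth (deeper _ _ _) = refl

  parent-child : ∀ (v : V m) {k} → depth v ≡ suc k → ChildOf (parent v) v
  parent-child (just (a , []))     _ = fromRoot a
  parent-child (just (a , c ∷ cs)) _ = deeper a c cs

  depth-parent : ∀ (v : V m) → depth (parent v) ≡ depth v ∸ 1
  depth-parent nothing            = refl
  depth-parent (just (_ , []))    = refl
  depth-parent (just (_ , _ ∷ _)) = refl

  depth≡0⇒root : ∀ (v : V m) → depth v ≡ 0 → v ≡ root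
  depth≡0⇒root nothing _ = refl

  ancestor-parent : ∀ k (x : V m) → ancestor k (parent x) ≡ parent (ancestor k x)
  ancestor-parent zero    x = refl
  ancestor-parent (suc k) x = ancestor-parent k (parent x)

  ancestor-+ : ∀ a t (x : V m) → ancestor (a + t) x ≡ ancestor t (ancestor a x)
  ancestor-+ zero    t x = refl
  ancestor-+ (suc a) t x = ancestor-+ a t (parent x)

  depth-ancestor : ∀ k (x : V m) → depth (ancestor k x) ≡ depth x ∸ k
  depth-ancestor zero    x = refl
  depth-ancestor (suc k) x = begin
    depth (ancestor k (parent x)) ≡⟨ depth-ancestor k (parent x) ⟩
    depth (parent x) ∸ k          ≡⟨ cong (_∸ k) (depth-parent x) ⟩
    depth x ∸ 1 ∸ k               ≡⟨ ∸-+-assoc (depth x) 1 k ⟩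
    depth x ∸ suc k               ∎
    where open ≡-Reasoning

  ancestor-root : ∀ k (x : V m) → depth x ≤ k → ancestor k x ≡ root
  ancestor-root k x dx≤k = depth≡0⇒root _ (trans (depth-ancestor k x) (m≤n⇒m∸n≡0 dx≤k))

  _++ʷ_ : ∀ {x y z : V m} {a b} → Walk x y a → Walk y z b → Walk x z (a + b)
  here     ++ʷ w′ = w′
  step e w ++ʷ w′ = step e (w ++ʷ w′)

  reverseʷ : ∀ {x y : V m} {a} → Walk x y a → Walk y x a
  reverseʷ here                 = here
  reverseʷ (step {d = d} e w) = subst (Walk _ _) (+-comm d 1) (reverseʷ w ++ʷ step (swap e) here)

  neighbour : V m → V m
  neighbour nothing  = just (fzero , [])
  neighbour (just v) = parent (just v)

  adj-neighbour : ∀ (x : V m) → Adj x (neighbour x)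
  adj-neighbour nothing             = inj₁ (fromRoot fzero)
  adj-neighbour (just (a , []))     = inj₂ (fromRoot a)
  adj-neighbour (just (a , c ∷ cs)) = inj₂ (deeper a c cs)

  bounce : ∀ (x : V m) t → Walk x x (double t)
  bounce x zero    = here
  bounce x (suc t) = step (adj-neighbour x) (step (swap (adj-neighbour x)) (bounce x t))

  walk-up : ∀ k (v : V m) → k ≤ depth v → Walk v (ancestor k v) k
  walk-up zero    v _          = here
  walk-up (suc k) v 1+k≤dv with depth v in dv
  ... | suc _ = step (inj₂ (parent-child v dv))
                     (walk-up k (parent v) (subst (k ≤_) (sym (trans (depth-parent v) (cong (_∸ 1) dv))) (≤-pred 1+k≤dv)))

  record WalkShape (v x : V m) (d : ℕ) : Set where
    constructor shape
    field
      up down loops : ℕ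
      length≡ : up + down + double loops ≡ d
      up≤     : up ≤ depth v
      down≤   : down ≤ depth x
      meet    : ancestor up v ≡ ancestor down x

  shape⇒walk : ∀ {v x : V m} {d} → WalkShape v x d → Walk v x d
  shape⇒walk {v} {x} (shape a b t refl a≤ b≤ meet) =
    subst (Walk v x) (trans (cong (a +_) (+-comm (double t) b)) (sym (+-assoc a b (double t))))
      (walk-up a v a≤ ++ʷ subst (λ y → Walk y x (double t + b)) (sym meet)
                                 (bounce (ancestor b x) t ++ʷ reverseʷ (walk-up b x b≤)))

  walk⇒shape : ∀ {v x : V m} {d} → Walk v x d → WalkShape v x d
  walk⇒shape here = shape 0 0 0 refl z≤n z≤n refl
  walk⇒shape (step (inj₂ y→v) w) with walk⇒shape w
  ... | shape a b t len a≤ b≤ meet =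
    shape (suc a) b t (cong suc len) (subst (suc a ≤_) (sym (child-depth y→v)) (s≤s a≤)) b≤
          (trans (cong (ancestor a) (child-parent y→v)) meet)
  walk⇒shape (step (inj₁ v→y) w) with walk⇒shape w
  ... | shape (suc a) b t len a≤ b≤ meet =
    shape a b (suc t) (trans (+-suc (a + b) _) (cong suc (trans (+-suc (a + b) _) len)))
          (≤-pred (subst (suc a ≤_) (child-depth v→y) a≤)) b≤
          (trans (cong (ancestor a) (sym (child-parent v→y))) meet)
  ... | shape zero b t len _ _ meet =
    shape 0 (suc b) t (cong suc len) z≤n b<dx
          (trans (sym (child-parent v→y)) (trans (cong parent meet) (sym (ancestor-parent b _))))
    where
    dx∸b≡1+dv : depth _ ∸ b ≡ suc (depth _)
    dx∸b≡1+dv = trans (sym (depth-ancestor b _)) (trans (cong depth (sym meet)) (child-depth v→y))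
    b<dx : b < depth _
    b<dx = m∸n≢0⇒n<m (λ dx∸b≡0 → 0≢1+n (trans (sym dx∸b≡0) dx∸b≡1+dv))

  double-+ : ∀ a t → a + a + double t ≡ double (a + t)
  double-+ a t = trans (cong (_+ double t) (sym (double≡+ a))) (sym (double-distrib-+ a t))

  shape-sameDepth : ∀ {u x : V m} {d} → depth u ≡ depth x → (s : WalkShape u x d) →
                    WalkShape.up s ≡ WalkShape.down s
  shape-sameDepth {u} {x} du≡dx (shape a b _ _ a≤ b≤ meet) =
    ∸-cancelˡ-≡ a≤ (subst (b ≤_) (sym du≡dx) b≤) (begin
      depth u ∸ a             ≡⟨ depth-ancestor a u ⟨
      depth (ancestor a u)    ≡⟨ cong depth meet ⟩
      depth (ancestor b x)    ≡⟨ depth-ancestor b x ⟩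
      depth x ∸ b             ≡⟨ cong (_∸ b) du≡dx ⟨
      depth u ∸ b             ∎)
    where open ≡-Reasoning

  shape-sameDepth-length : ∀ {u x : V m} {d} → depth u ≡ depth x → (s : WalkShape u x d) →
                           double (WalkShape.up s + WalkShape.loops s) ≡ d
  shape-sameDepth-length du≡dx s@(shape a _ t len _ _ _) with shape-sameDepth du≡dx s
  ... | refl = trans (sym (double-+ a t)) len

  walk-sameDepth-odd : ∀ {u x : V m} {k} → depth u ≡ depth x → ¬ Walk u x (suc (double k))
  walk-sameDepth-odd {k = k} du≡dx w =
    let s = walk⇒shape w in
    double≢suc-double (WalkShape.up s + WalkShape.loops s) k (shape-sameDepth-length du≡dx s)

  walk-sameDepth-even : ∀ {u x : V m} {k} → depth u ≡ depth x →
                        Walk u x (double k) ⇔ (ancestor k u ≡ ancestor k x)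
  walk-sameDepth-even {u} {x} {k} du≡dx = mk⇔ to′ from′
    where
    to′ : Walk u x (double k) → ancestor k u ≡ ancestor k x
    to′ w with walk⇒shape w
    ... | s@(shape a _ t _ _ _ meet) with shape-sameDepth du≡dx s | double-injective (shape-sameDepth-length du≡dx s)
    ... | refl | refl = begin
      ancestor (a + t) u            ≡⟨ ancestor-+ a t u ⟩
      ancestor t (ancestor a u)     ≡⟨ cong (ancestor t) meet ⟩
      ancestor t (ancestor a x)     ≡⟨ ancestor-+ a t x ⟨
      ancestor (a + t) x            ∎
      where open ≡-Reasoning
    from′ : ancestor k u ≡ ancestor k x → Walk u x (double k)
    from′ meet with k ≤? depth u
    ... | yes k≤du = shape⇒walk (shape k k 0 (trans (double-+ k 0) (cong double (+-identityʳ k)))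
                                       k≤du (subst (k ≤_) du≡dx k≤du) meet)
    ... | no  k≰du = shape⇒walk (shape e e (k ∸ e) (trans (double-+ e (k ∸ e)) (cong double (m+[n∸m]≡n e≤k)))
                                       ≤-refl (≤-reflexive du≡dx)
                                       (trans (ancestor-root e u ≤-refl) (sym (ancestor-root e x (≤-reflexive (sym du≡dx))))))
      where
      e = depth u
      e≤k : e ≤ k
      e≤k = <⇒≤ (≰⇒> k≰du)

  walk-via-parent : ∀ {v x : V m} {d} → depth x < depth v → Walk v x (suc d) → Walk (parent v) x d
  walk-via-parent {v} {x} dx<dv w with walk⇒shape w
  ... | shape zero b t _ _ _ v≡anc =
    ⊥-elim (<⇒≱ dx<dv (subst (_≤ depth x) (cong depth (sym v≡anc))
                             (subst (_≤ depth x) (sym (depth-ancestor b x)) (m∸n≤m (depth x) b))))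
  ... | shape (suc a) b t len a≤ b≤ meet =
    shape⇒walk (shape a b t (suc-injective len) (subst (a ≤_) (sym (depth-parent v)) (∸-monoˡ-≤ 1 a≤)) b≤ meet)

  Pset⇔depth≤ : ∀ n (x : V m) → Pset n x ⇔ depth x ≤ n
  Pset⇔depth≤ zero    x = mk⇔ (λ { refl → z≤n }) (depth≡0⇒root x ∘ n≤0⇒n≡0)
  Pset⇔depth≤ (suc n) x = mk⇔ to′ from′
    where
    to′ : Pset (suc n) x → depth x ≤ suc n
    to′ (y , y∈P , inj₁ refl)      = m≤n⇒m≤1+n (to (Pset⇔depth≤ n y) y∈P)
    to′ (y , y∈P , inj₂ (inj₁ x→y)) =
      m≤n⇒m≤1+n (≤-trans (n≤1+n _) (subst (_≤ n) (child-depth x→y) (to (Pset⇔depth≤ n y) y∈P)))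
    to′ (y , y∈P , inj₂ (inj₂ y→x)) = subst (_≤ suc n) (sym (child-depth y→x)) (s≤s (to (Pset⇔depth≤ n y) y∈P))
    from′ : depth x ≤ suc n → Pset (suc n) x
    from′ dx≤1+n with depth x ≤? n
    ... | yes dx≤n = x , from (Pset⇔depth≤ n x) dx≤n , inj₁ refl
    ... | no  dx≰n = parent x , from (Pset⇔depth≤ n (parent x)) (≤-reflexive (trans (depth-parent x) (cong (_∸ 1) dx≡1+n))) ,
                     inj₂ (inj₂ (parent-child x dx≡1+n))
      where
      dx≡1+n : depth x ≡ suc n
      dx≡1+n = ≤-antisym dx≤1+n (≰⇒> dx≰n)

  Rset⇔depth≡ : ∀ n (x : V m) → Rset n x ⇔ depth x ≡ n
  Rset⇔depth≡ zero    x = mk⇔ (n≤0⇒n≡0 ∘ to (Pset⇔depth≤ 0 x)) (from (Pset⇔depth≤ 0 x) ∘ ≤-reflexive)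
  Rset⇔depth≡ (suc n) x = mk⇔
    (λ (x∈P , x∉P) → ≤-antisym (to (Pset⇔depth≤ (suc n) x) x∈P) (≰⇒> (x∉P ∘ from (Pset⇔depth≤ n x))))
    (λ dx≡1+n → from (Pset⇔depth≤ (suc n) x) (≤-reflexive dx≡1+n) ,
                <⇒≱ (≤-reflexive (sym dx≡1+n)) ∘ to (Pset⇔depth≤ n x))

  walk-from-root : ∀ (x : V m) → Walk root x (depth x)
  walk-from-root x = shape⇒walk (shape 0 (depth x) 0 (+-identityʳ (depth x)) z≤n ≤-refl (sym (ancestor-root (depth x) x ≤-refl)))

  walk-from-root-≥depth : ∀ {x : V m} {d} → Walk root x d → depth x ≤ d
  walk-from-root-≥depth {x} w with walk⇒shape w
  ... | shape zero b t refl _ _ root≡anc =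
    ≤-trans (m∸n≡0⇒m≤n (trans (sym (depth-ancestor b x)) (cong depth (sym root≡anc)))) (m≤m+n b (double t))

  geodesicRay-depth : ∀ (O : ℕ → V m) → IsGeodesicRay O → ∀ n → depth (O n) ≡ n
  geodesicRay-depth O (O₀≡root , dist) n with dist 0 n
  ... | w , minimal rewrite O₀≡root = ≤-antisym (walk-from-root-≥depth w) (minimal (depth (O n)) (walk-from-root (O n)))

  level-hasSize : ∀ r → HasSize (λ (x : V m) → depth x ≡ r) (levelSize m r)
  level-hasSize zero    = hasSize-resp (λ x → mk⇔ (λ { refl → refl }) (depth≡0⇒root x)) (hasSize-singleton root)
  level-hasSize (suc r) =
    hasSize-resp (λ x → mk⇔ (λ { (_ , (_ , ℓ≡r) , refl) → cong suc ℓ≡r }) (unjust x))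
      (hasSize-image just just-injective (hasSize-× (hasSize-Fin (suc m)) (hasSize-lists (hasSize-Fin m) r)))
    where
    unjust : ∀ x → depth x ≡ suc r → ∃ λ (a , cs) → (⊤ × length cs ≡ r) × x ≡ just (a , cs)
    unjust (just (a , cs)) dx≡1+r = (a , cs) , (tt , suc-injective dx≡1+r) , refl

  ancestor-++ : ∀ a (ds cs : List (Fin m)) → ancestor (length ds) (just (a , ds ++ cs)) ≡ just (a , cs)
  ancestor-++ a []       cs = refl
  ancestor-++ a (_ ∷ ds) cs = ancestor-++ a ds cs

  descendant : ∀ a cs k (x : V m) → depth x ≡ k + depth (just (a , cs)) → ancestor k x ≡ just (a , cs) →
               ∃ λ ds → length ds ≡ k × x ≡ just (a , ds ++ cs)
  descendant a cs zero x _ refl = [] , refl , refl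
  descendant a cs (suc k) (just (_ , [])) dx _ = ⊥-elim (0≢1+n (trans (suc-injective dx) (+-suc k (length cs))))
  descendant a cs (suc k) (just (b , c ∷ es)) dx anc with descendant a cs k (just (b , es)) (suc-injective dx) anc
  ... | ds , refl , refl = c ∷ ds , refl , refl

  descendants-hasSize : ∀ a cs k →
    HasSize (λ (x : V m) → depth x ≡ k + depth (just (a , cs)) × ancestor k x ≡ just (a , cs)) (m ^ k)
  descendants-hasSize a cs k =
    hasSize-resp (λ x → mk⇔ (λ { (ds , refl , refl) → depth-++ ds , ancestor-++ a ds cs })
                             (λ (dx , anc) → descendant a cs k x dx anc))
      (hasSize-image (λ ds → just (a , ds ++ cs)) (++-cancelʳ cs _ _ ∘ cong proj₂ ∘ just-injective)
                     (hasSize-lists (hasSize-Fin m) k))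
    where
    depth-++ : ∀ ds → suc (length (ds ++ cs)) ≡ length ds + suc (length cs)
    depth-++ ds = trans (cong suc (length-++ ds)) (sym (+-suc (length ds) (length cs)))

  sameDepth-ancestor-hasSize-< : ∀ {k} (u : V m) → k < depth u →
    HasSize (λ x → depth x ≡ depth u × ancestor k u ≡ ancestor k x) (m ^ k)
  sameDepth-ancestor-hasSize-< {k} u k<du with ancestor k u | depth-ancestor k u
  ... | nothing       | 0≡du∸k = ⊥-elim (<⇒≱ k<du (m∸n≡0⇒m≤n (sym 0≡du∸k)))
  ... | just (a , cs) | da≡du∸k =
    hasSize-resp (λ x → mk⇔ (λ (dx , anc) → trans dx (sym du≡) , sym anc) (λ (dx , anc) → trans dx du≡ , sym anc))
      (descendants-hasSize a cs k)
    where
    du≡ : depth u ≡ k + suc (length cs)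
    du≡ = trans (sym (m+[n∸m]≡n (<⇒≤ k<du))) (cong (k +_) (sym da≡du∸k))

  sameDepth-ancestor-hasSize-≥ : ∀ {k} (u : V m) → depth u ≤ k →
    HasSize (λ x → depth x ≡ depth u × ancestor k u ≡ ancestor k x) (levelSize m (depth u))
  sameDepth-ancestor-hasSize-≥ {k} u du≤k =
    hasSize-resp (λ x → mk⇔ (λ dx → dx , trans (ancestor-root k u du≤k) (sym (ancestor-root k x (subst (_≤ k) (sym dx) du≤k))))
                             proj₁)
      (level-hasSize (depth u))

module _ {m : ℕ} .{{_ : NonZero m}} where

  sameDepthWalks-hasSize : ∀ {e} (u : V m) → depth u ≡ e → ∀ j → HasSize (λ x → depth x ≡ e × Walk u x j) (ζ m e j)
  sameDepthWalks-hasSize u refl j with parity j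
  ... | odd k = subst (HasSize _) (sym (ζ-odd m (depth u) k))
                      (hasSize-∅ λ x (dx , w) → walk-sameDepth-odd (sym dx) w)
  ... | even k = hasSize-resp walks⇔ sameAncestor-hasSize
    where
    walks⇔ : ∀ x → (depth x ≡ depth u × ancestor k u ≡ ancestor k x) ⇔ (depth x ≡ depth u × Walk u x (double k))
    walks⇔ x = mk⇔ (λ (dx , anc) → dx , from (walk-sameDepth-even (sym dx)) anc)
                   (λ (dx , w) → dx , to (walk-sameDepth-even (sym dx)) w)
    sameAncestor-hasSize : HasSize (λ x → depth x ≡ depth u × ancestor k u ≡ ancestor k x) (ζ m (depth u) (double k))
    sameAncestor-hasSize with k <? depth u
    ... | yes k<du = subst (HasSize _) (sym (ζ-double-< m (depth u) k k<du)) (sameDepth-ancestor-hasSize-< u k<du)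
    ... | no  k≮du = subst (HasSize _) (sym (ζ-double-≥ m (depth u) k (≮⇒≥ k≮du))) (sameDepth-ancestor-hasSize-≥ u (≮⇒≥ k≮du))

  ballWalks-hasSize : ∀ n (v : V m) → depth v ≡ n → ∀ d → HasSize (λ x → depth x ≤ n × Walk v x d) (ζᴾ m n d)
  ballWalks-hasSize zero v dv d =
    subst (HasSize _) (sym (ζᴾ-zero m d))
      (hasSize-resp (λ x → mk⇔ ≤-reflexive n≤0⇒n≡0 ×-⇔ ⇔-refl) (sameDepthWalks-hasSize v dv d))
  ballWalks-hasSize (suc n) v dv zero =
    hasSize-resp (λ x → mk⇔ (λ { refl → ≤-reflexive dv , here }) (λ { (_ , here) → refl })) (hasSize-singleton v)
  ballWalks-hasSize (suc n) v dv (suc d) =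
    subst (HasSize _) (sym (ζᴾ-suc m n d))
      (hasSize-resp ball⇔ (hasSize-⊎ (λ x (dx , _) (dx≤n , _) → <⇒≱ (≤-reflexive (sym dx)) dx≤n)
                                      (sameDepthWalks-hasSize v dv (suc d))
                                      (ballWalks-hasSize n (parent v) (trans (depth-parent v) (cong (_∸ 1) dv)) d)))
    where
    ball⇔ : ∀ x → (depth x ≡ suc n × Walk v x (suc d) ⊎ depth x ≤ n × Walk (parent v) x d) ⇔
                  (depth x ≤ suc n × Walk v x (suc d))
    ball⇔ x = mk⇔ (λ { (inj₁ (dx , w)) → ≤-reflexive dx , w
                     ; (inj₂ (dx≤n , w)) → m≤n⇒m≤1+n dx≤n , step (inj₂ (parent-child v dv)) w })
                  λ (dx≤1+n , w) → case depth x ≤? n of λ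
                    { (yes dx≤n) → inj₂ (dx≤n , walk-via-parent (subst (depth x <_) (sym dv) (s≤s dx≤n)) w)
                    ; (no dx≰n)  → inj₁ (≤-antisym dx≤1+n (≰⇒> dx≰n) , w) }

  zetaCoeff : ∀ {n} (v : V m) → depth v ≡ n → ∀ d → ZetaCoeff v d (ζ m n d)
  zetaCoeff {n} v dv d = n , from (Rset⇔depth≡ n v) dv ,
    hasSize-resp (λ x → ⇔-sym (Rset⇔depth≡ n x) ×-⇔ ⇔-refl) (sameDepthWalks-hasSize v dv d)

  zetaPCoeff : ∀ {n} (v : V m) → depth v ≡ n → ∀ d → ZetaPCoeff v d (ζᴾ m n d)
  zetaPCoeff {n} v dv d = n , from (Rset⇔depth≡ n v) dv ,
    hasSize-resp (λ x → ⇔-sym (Pset⇔depth≤ n x) ×-⇔ ⇔-refl) (ballWalks-hasSize n v dv d)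

proposition3p5 : (m : ℕ) → 2 ≤ m → (O : ℕ → V m) → IsGeodesicRay O →
    (n : ℕ) → 1 ≤ n →
      ((d : ℕ) → ZetaCoeff (O n) d (divOneMinusX² (num₁ m n) d))
      × ((d : ℕ) → ZetaPCoeff (O n) d (divOneMinusX² (num₂ m n) d))
proposition3p5 (suc _) _ O ray n _ =
  zetaCoeff (O n) (geodesicRay-depth O ray n) , zetaPCoeff (O n) (geodesicRay-depth O ray n)
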